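{- Let $n\ge 1$, let $i\in\{1,\dots,n-1\}$, and let $C$ be a set of transpositions in $S_n$ which is $s_i$-stable, i.e. $s_i\in C$ and $s_iCs_i=C$. Then the divided difference operator $\partial_i$ is defined on all of $H_C$, and $\partial_i(H_C)\subseteq H_C$.
   Context: Permutations compose as functions: $(vw)(j)=v(w(j))$. $s_i=(i\leftrightarrow i+1)$ denotes the adjacent transposition. Let $H=\operatorname{Fun}(S_n,\mathbb{C}[t_1,\dots,t_n])$ be the ring of functions from $S_n$ to the polynomial ring, with pointwise operations; write $f(v)=f(v;t_1,\dots,t_n)$. The star action is the right action $(f*w)(v)=f(vw^{ -1})$ for $w\in S_n$, extended linearly to elements of the group algebra (e.g. $f*(1-w)=f-f*w$). In $H$, $t_j$ denotes the constant function $v\mapsto t_j$ and $x_j$ denotes the function $v\mapsto t_{v(j)}$. For a transposition $\tau=(j\leftrightarrow k)$, an element $f\in H$ satisfies condition $\tau$ if there exists $g\in H$ with $f-f*\tau=(x_j-x_k)g$; the set of such $f$ is a subring $H_\tau$, and for a set $C$ of transpositions $H_C=\bigcap_{\tau\in C}H_\tau$ (with $H_\varnothing=H$). For $f\in H_{s_i}$, the divided difference $\partial_i(f)$ is the unique $g\in H$ with $f-f*s_i=(x_i-x_{i+1})g$ (so $\partial_i$ is defined exactly on $H_{s_i}$). -}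

module Defs where

open import Level using (Level; _⊔_)
open import Algebra.Bundles using (CommutativeRing)
open import Data.Nat as ℕ using (ℕ)
open import Data.Fin as Fin using (Fin)
open import Data.Fin.Permutation as P using (Permutation′; _⟨$⟩ʳ_; _∘ₚ_; transpose)
open import Data.Vec as Vec using (Vec; replicate; zipWith; _[_]≔_)
open import Data.Vec.Properties using (≡-dec)
open import Data.List as List using (List; []; _∷_; _++_; concatMap)
open import Data.Product using (_×_; _,_; Σ; ∃-syntax)
open import Data.Sum using (_⊎_)
open import Relation.Nullary using (¬_; yes; no)
open import Relation.Binary.PropositionalEquality using (_≡_; _≢_)

-- The symmetric group S_n, as permutations of Fin n, with extensional
-- equality.  Product in the paper's convention: (v · w)(j) = v (w j).

Perm : ℕ → Set
Perm = Permutation′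

_≈ₚ_ : ∀ {n} → Perm n → Perm n → Set
_≈ₚ_ = P._≈_

_·_ : ∀ {n} → Perm n → Perm n → Perm n
v · w = w ∘ₚ v

_⁻¹ : ∀ {n} → Perm n → Perm n
_⁻¹ = P.flip

IsTransposition : ∀ {n} → Perm n → Set
IsTransposition {n} σ = ∃[ j ] ∃[ k ] (j ≢ k × σ ≈ₚ transpose j k)

-- A polynomial is a finite formal sum of
-- terms  a · t^m  (m : Vec ℕ n the exponent vector); two polynomials are equal
-- iff all their coefficients agree.

module Poly {c ℓ : Level} (K : CommutativeRing c ℓ) (n : ℕ) where
  open CommutativeRing K renaming (Carrier to A)

  Mon : Set
  Mon = Vec ℕ n

  Pol : Set c
  Pol = List (A × Mon)

  coeff : Pol → Mon → A
  coeff []             m = 0#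
  coeff ((a , m') ∷ p) m with ≡-dec ℕ._≟_ m' m
  ... | yes _ = a + coeff p m
  ... | no  _ = coeff p m

  _≈ᴾ_ : Pol → Pol → Set ℓ
  p ≈ᴾ q = ∀ m → coeff p m ≈ coeff q m

  _+ᴾ_ : Pol → Pol → Pol
  p +ᴾ q = p ++ q

  -ᴾ_ : Pol → Pol
  -ᴾ p = List.map (λ { (a , m) → (- a , m) }) p

  _-ᴾ_ : Pol → Pol → Pol
  p -ᴾ q = p +ᴾ (-ᴾ q)

  _*ᴾ_ : Pol → Pol → Pol
  p *ᴾ q = concatMap (λ { (a , m) → List.map (λ { (b , m') → (a * b , zipWith ℕ._+_ m m') }) q }) p

  var : Fin n → Pol
  var j = (1# , replicate n 0 [ j ]≔ 1) ∷ []

module GKM {c ℓ : Level} (K : CommutativeRing c ℓ) (n : ℕ) where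
  open Poly K n public

  H : Set c
  H = Perm n → Pol

  InH : H → Set ℓ
  InH f = ∀ {v w} → v ≈ₚ w → f v ≈ᴾ f w

  _≈ᴴ_ : H → H → Set ℓ
  f ≈ᴴ g = ∀ v → f v ≈ᴾ g v

  _-ᴴ_ : H → H → H
  (f -ᴴ g) v = f v -ᴾ g v

  _*ᴴ_ : H → H → H
  (f *ᴴ g) v = f v *ᴾ g v

  _⋆_ : H → Perm n → H
  (f ⋆ w) v = f (v · (w ⁻¹))

  tᴴ : Fin n → H
  tᴴ j v = var j

  xᴴ : Fin n → H
  xᴴ j v = var (v ⟨$⟩ʳ j)

  Cond : Fin n → Fin n → H → Set (c ⊔ ℓ)
  Cond j k f = Σ H λ g → InH g × ((f -ᴴ (f ⋆ transpose j k)) ≈ᴴ ((xᴴ j -ᴴ xᴴ k) *ᴴ g))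

  InH[_] : ∀ {p} → (Perm n → Set p) → H → Set (c ⊔ ℓ ⊔ p)
  InH[ C ] f = InH f × (∀ j k → j ≢ k → C (transpose j k) → Cond j k f)

  IsDivDiff : Fin n → Fin n → H → H → Set ℓ
  IsDivDiff j k f g = InH g × ((f -ᴴ (f ⋆ transpose j k)) ≈ᴴ ((xᴴ j -ᴴ xᴴ k) *ᴴ g))

IsIntegralDomain : ∀ {c ℓ} → CommutativeRing c ℓ → Set (c ⊔ ℓ)
IsIntegralDomain K = ¬ (1# ≈ 0#) × (∀ a b → a * b ≈ 0# → a ≈ 0# ⊎ b ≈ 0#)
  where open CommutativeRing K

{-# OPTIONS --safe #-}
module Submission where

-- Work coefficientwise in K[t₁,…,tₙ].  A polynomial is divisible by t_a − t_b exactly when it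
-- vanishes after substituting t_b for t_a (the quotient can be written down explicitly), and
-- t_a − t_b is a non-zero-divisor.
--
-- Let s = (p q) be the transposition of the divided difference, τ = (j k) ∈ C and v ∈ Sₙ; put
-- α = v(j), β = v(k).  The divided difference g satisfies
--   (x_p − x_q)(v) g(v) = f(v) − f(vs)   and   (x_p − x_q)(vτ) g(vτ) = f(vτ) − f(vτs).
-- If τ = s, comparing the identities at v and vs already gives g(v) = g(vs).  Otherwise
-- substitute t_β for t_α: both factors x_p − x_q become the same polynomial, which is still
-- a non-zero-divisor because {p, q} ≠ {j, k}, while the difference of the right-hand sides is
--   (f(v) − f(vτ)) − (f(vs) − f(vs·sτs)),
-- which vanishes since f satisfies the conditions τ and sτs ∈ C.  So g(v) − g(vτ) vanishes at
-- t_α = t_β, i.e. is divisible by t_α − t_β.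

open import Defs
open import Level using (Level)
open import Algebra.Bundles using (CommutativeRing)
open import Data.Nat using (ℕ; suc)
open import Data.Fin using (Fin; inject₁) renaming (suc to fsuc)
open import Data.Fin.Permutation using (transpose)
open import Data.Product using (_×_)

open import Data.Nat as ℕ using (zero; _∸_; _≤_; _<_)
import Data.Nat.Properties as ℕₚ
open import Data.Fin as Fin using (toℕ; _≟_)
open import Data.Fin.Properties using (toℕ-fromℕ; toℕ-inject₁; toℕ≤pred[n])
import Data.Fin.Properties as Finₚ
import Data.Fin.Permutation.Components as PC
open import Data.Fin.Permutation using (_⟨$⟩ʳ_; _⟨$⟩ˡ_)
open import Data.Product using (_,_; map₂)
open import Data.Sum using (_⊎_; inj₁; inj₂)
open import Data.List as List using ([]; _∷_; _++_)
open import Data.Vec using (Vec; []; _∷_; lookup; _[_]≔_; replicate; zipWith)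
open import Data.Vec.Properties
  using (≡-dec; ∷-injectiveˡ; ∷-injectiveʳ; zipWith-identityˡ; lookup∘update; lookup∘update′;
         []≔-idempotent; []≔-commutes; []≔-lookup)
open import Data.Maybe using (nothing)
open import Function using (Injection; _∘_)
open import Function.Properties.Inverse using (↔⇒↣)
open import Relation.Nullary using (¬_; Dec; yes; no; contradiction)
open import Relation.Nullary.Decidable using (dec-true; dec-false; _×-dec_; _⊎-dec_)
open import Relation.Binary.Bundles using (Setoid)
open import Relation.Binary.PropositionalEquality as ≡ using (_≡_; _≢_)
import Relation.Binary.Reasoning.Setoid as ≈-Reasoning

module _ {n : ℕ} where
  open ≡ using (refl; sym; trans; cong)

  transpose-matchˡ : ∀ (i j : Fin n) → PC.transpose i j i ≡ j
  transpose-matchˡ i j rewrite dec-true (i ≟ i) refl = refl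

  transpose-matchʳ : ∀ (i j : Fin n) → PC.transpose i j j ≡ i
  transpose-matchʳ i j with j ≟ i
  ... | yes j≡i = j≡i
  ... | no _ rewrite dec-true (j ≟ j) refl = refl

  transpose-other : ∀ {i j k : Fin n} → k ≢ i → k ≢ j → PC.transpose i j k ≡ k
  transpose-other {i} {j} {k} k≢i k≢j rewrite dec-false (k ≟ i) k≢i | dec-false (k ≟ j) k≢j = refl

  transpose-comm : ∀ (i j k : Fin n) → PC.transpose i j k ≡ PC.transpose j i k
  transpose-comm i j k = by-cases (k ≟ i) (k ≟ j)
    where
    by-cases : Dec (k ≡ i) → Dec (k ≡ j) → PC.transpose i j k ≡ PC.transpose j i k
    by-cases (yes refl) _          = trans (transpose-matchˡ k j) (sym (transpose-matchʳ j k))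
    by-cases (no _)     (yes refl) = trans (transpose-matchʳ i k) (sym (transpose-matchˡ k i))
    by-cases (no k≢i)   (no k≢j)   = trans (transpose-other k≢i k≢j) (sym (transpose-other k≢j k≢i))

  transpose-involutive : ∀ (i j k : Fin n) → PC.transpose i j (PC.transpose i j k) ≡ k
  transpose-involutive i j k =
    trans (cong (PC.transpose i j) (transpose-comm i j k)) (PC.transpose-inverse i j)

  ⟨$⟩ʳ-injective : ∀ (π : Perm n) {i j} → π ⟨$⟩ʳ i ≡ π ⟨$⟩ʳ j → i ≡ j
  ⟨$⟩ʳ-injective π = Injection.injective (↔⇒↣ π)

  ⟨$⟩ʳ-≢ : ∀ (π : Perm n) {i j} → i ≢ j → π ⟨$⟩ʳ i ≢ π ⟨$⟩ʳ j
  ⟨$⟩ʳ-≢ π i≢j = i≢j ∘ ⟨$⟩ʳ-injective π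

  ⟨$⟩ʳ-transpose : ∀ (π : Perm n) i j x →
                   π ⟨$⟩ʳ PC.transpose i j x ≡ PC.transpose (π ⟨$⟩ʳ i) (π ⟨$⟩ʳ j) (π ⟨$⟩ʳ x)
  ⟨$⟩ʳ-transpose π i j x = by-cases (x ≟ i) (x ≟ j)
    where
    πi πj πx : Fin n
    πi = π ⟨$⟩ʳ i
    πj = π ⟨$⟩ʳ j
    πx = π ⟨$⟩ʳ x

    by-cases : Dec (x ≡ i) → Dec (x ≡ j) → π ⟨$⟩ʳ PC.transpose i j x ≡ PC.transpose πi πj πx
    by-cases (yes refl) _      = trans (cong (π ⟨$⟩ʳ_) (transpose-matchˡ x j)) (sym (transpose-matchˡ πx πj))
    by-cases (no _) (yes refl) = trans (cong (π ⟨$⟩ʳ_) (transpose-matchʳ i x)) (sym (transpose-matchʳ πi πx))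
    by-cases (no x≢i) (no x≢j) = trans (cong (π ⟨$⟩ʳ_) (transpose-other x≢i x≢j))
                                       (sym (transpose-other (⟨$⟩ʳ-≢ π x≢i) (⟨$⟩ʳ-≢ π x≢j)))

  -- The effect of substituting t_b for t_a on the index of a variable t_x.
  redirect : Fin n → Fin n → Fin n → Fin n
  redirect a b x with x ≟ a
  ... | yes _ = b
  ... | no  _ = x

  redirect-source : ∀ a b → redirect a b a ≡ b
  redirect-source a b with a ≟ a
  ... | yes _   = refl
  ... | no a≢a = contradiction refl a≢a

  redirect-other : ∀ {a b x} → x ≢ a → redirect a b x ≡ x
  redirect-other {a} {b} {x} x≢a with x ≟ a
  ... | yes x≡a = contradiction x≡a x≢a
  ... | no _    = refl

  redirect-transpose : ∀ {a b} → a ≢ b → ∀ x → redirect a b (PC.transpose b a x) ≡ redirect a b x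
  redirect-transpose {a} {b} a≢b x = by-cases (x ≟ b) (x ≟ a)
    where
    b≢a : b ≢ a
    b≢a = a≢b ∘ sym

    by-cases : Dec (x ≡ b) → Dec (x ≡ a) → redirect a b (PC.transpose b a x) ≡ redirect a b x
    by-cases (yes refl) _      = trans (cong (redirect a b) (transpose-matchˡ b a))
                                       (trans (redirect-source a b) (sym (redirect-other b≢a)))
    by-cases (no _) (yes refl) = trans (cong (redirect a b) (transpose-matchʳ b a))
                                       (trans (redirect-other b≢a) (sym (redirect-source a b)))
    by-cases (no x≢b) (no x≢a) = cong (redirect a b) (transpose-other x≢b x≢a)

  redirect-collision : ∀ {a b x y} → x ≢ y → redirect a b x ≡ redirect a b y →
                       (x ≡ a × y ≡ b) ⊎ (x ≡ b × y ≡ a)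
  redirect-collision {a} {b} {x} {y} x≢y x′≡y′ = by-cases (x ≟ a) (y ≟ a)
    where
    by-cases : Dec (x ≡ a) → Dec (y ≡ a) → (x ≡ a × y ≡ b) ⊎ (x ≡ b × y ≡ a)
    by-cases (yes x≡a) (yes y≡a) = contradiction (trans x≡a (sym y≡a)) x≢y
    by-cases (yes refl) (no y≢a) =
      inj₁ (refl , trans (sym (redirect-other y≢a)) (trans (sym x′≡y′) (redirect-source a b)))
    by-cases (no x≢a) (yes refl) =
      inj₂ (trans (sym (redirect-other x≢a)) (trans x′≡y′ (redirect-source a b)) , refl)
    by-cases (no x≢a) (no y≢a)   =
      contradiction (trans (sym (redirect-other x≢a)) (trans x′≡y′ (redirect-other y≢a))) x≢y

module _ {a} {A : Set a} {n : ℕ} {i j : Fin n} where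
  open ≡ using (refl; sym; trans; cong)

  lookup-[]≔²ˡ : i ≢ j → ∀ (xs : Vec A n) x y → lookup (xs [ i ]≔ x [ j ]≔ y) i ≡ x
  lookup-[]≔²ˡ i≢j xs x y = trans (lookup∘update′ i≢j (xs [ i ]≔ x) y) (lookup∘update i xs x)

  lookup-[]≔²ʳ : ∀ (xs : Vec A n) x y → lookup (xs [ i ]≔ x [ j ]≔ y) j ≡ y
  lookup-[]≔²ʳ xs x y = lookup∘update j (xs [ i ]≔ x) y

  lookup-[]≔²-other : ∀ {k} → k ≢ i → k ≢ j → ∀ (xs : Vec A n) x y →
                      lookup (xs [ i ]≔ x [ j ]≔ y) k ≡ lookup xs k
  lookup-[]≔²-other k≢i k≢j xs x y = trans (lookup∘update′ k≢j (xs [ i ]≔ x) y) (lookup∘update′ k≢i xs x)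

  []≔²-lookup : ∀ (xs : Vec A n) → xs [ i ]≔ lookup xs i [ j ]≔ lookup xs j ≡ xs
  []≔²-lookup xs = trans (cong (_[ j ]≔ lookup xs j) ([]≔-lookup xs i)) ([]≔-lookup xs j)

  []≔²-overwriteˡ : i ≢ j → ∀ (xs : Vec A n) x y z → xs [ i ]≔ x [ j ]≔ y [ i ]≔ z ≡ xs [ i ]≔ z [ j ]≔ y
  []≔²-overwriteˡ i≢j xs x y z =
    trans ([]≔-commutes (xs [ i ]≔ x) j i (i≢j ∘ sym)) (cong (_[ j ]≔ y) ([]≔-idempotent xs i))

  []≔²-absorbˡ : ∀ (xs : Vec A n) x y z → xs [ i ]≔ z [ i ]≔ x [ j ]≔ y ≡ xs [ i ]≔ x [ j ]≔ y
  []≔²-absorbˡ xs x y z = cong (_[ j ]≔ y) ([]≔-idempotent xs i)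

  []≔²-absorbʳ : i ≢ j → ∀ (xs : Vec A n) x y z → xs [ j ]≔ z [ i ]≔ x [ j ]≔ y ≡ xs [ i ]≔ x [ j ]≔ y
  []≔²-absorbʳ i≢j xs x y z =
    trans (cong (_[ j ]≔ y) ([]≔-commutes xs j i (i≢j ∘ sym))) ([]≔-idempotent (xs [ i ]≔ x) j)

  []≔²-commutes : ∀ {k} → k ≢ i → k ≢ j → ∀ (xs : Vec A n) x y z →
                  xs [ i ]≔ x [ j ]≔ y [ k ]≔ z ≡ xs [ k ]≔ z [ i ]≔ x [ j ]≔ y
  []≔²-commutes k≢i k≢j xs x y z =
    trans ([]≔-commutes (xs [ i ]≔ x) j _ (k≢j ∘ sym)) (cong (_[ j ]≔ y) ([]≔-commutes xs i _ (k≢i ∘ sym)))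

raise : ∀ {n} → Fin n → Vec ℕ n → Vec ℕ n
raise x m = m [ x ]≔ suc (lookup m x)

unit+≡raise : ∀ {n} (x : Fin n) (m : Vec ℕ n) → zipWith ℕ._+_ (replicate n 0 [ x ]≔ 1) m ≡ raise x m
unit+≡raise Fin.zero    (y ∷ ys) = ≡.cong (suc y ∷_) (zipWith-identityˡ ℕₚ.+-identityˡ ys)
unit+≡raise (Fin.suc x) (y ∷ ys) = ≡.cong (y ∷_) (unit+≡raise x ys)

module _ {n : ℕ} {x : Fin n} where
  open ≡ using (refl; sym; trans; cong)

  raise-lower : ∀ {M k} → lookup M x ≡ suc k → raise x (M [ x ]≔ k) ≡ M
  raise-lower {M} {k} Mx≡1+k = begin
    M [ x ]≔ k [ x ]≔ suc (lookup (M [ x ]≔ k) x)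
      ≡⟨ cong (λ e → M [ x ]≔ k [ x ]≔ suc e) (lookup∘update x M k) ⟩
    M [ x ]≔ k [ x ]≔ suc k ≡⟨ []≔-idempotent M x ⟩
    M [ x ]≔ suc k          ≡⟨ cong (M [ x ]≔_) Mx≡1+k ⟨
    M [ x ]≔ lookup M x     ≡⟨ []≔-lookup M x ⟩
    M                       ∎
    where open ≡.≡-Reasoning

  raise≡⇒lower : ∀ {m M k} → lookup M x ≡ suc k → raise x m ≡ M → m ≡ M [ x ]≔ k
  raise≡⇒lower {m} {M} {k} Mx≡1+k refl = begin
    m                           ≡⟨ []≔-lookup m x ⟨
    m [ x ]≔ lookup m x         ≡⟨ []≔-idempotent m x ⟨
    raise x m [ x ]≔ lookup m x ≡⟨ cong (raise x m [ x ]≔_) mx≡k ⟩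
    raise x m [ x ]≔ k          ∎
    where
    open ≡.≡-Reasoning
    mx≡k : lookup m x ≡ k
    mx≡k = ℕₚ.suc-injective (trans (sym (lookup∘update x m _)) Mx≡1+k)

  raise≢ : ∀ {m M} → lookup M x ≡ 0 → raise x m ≢ M
  raise≢ {m} Mx≡0 refl = ℕₚ.1+n≢0 (trans (sym (lookup∘update x m _)) Mx≡0)

maxEntry : ∀ {n} → Vec ℕ n → ℕ
maxEntry []       = 0
maxEntry (e ∷ es) = e ℕ.⊔ maxEntry es

lookup≤maxEntry : ∀ {n} (M : Vec ℕ n) x → lookup M x ≤ maxEntry M
lookup≤maxEntry (e ∷ es) Fin.zero    = ℕₚ.m≤m⊔n e (maxEntry es)
lookup≤maxEntry (e ∷ es) (Fin.suc x) = ℕₚ.≤-trans (lookup≤maxEntry es x) (ℕₚ.m≤n⊔m e (maxEntry es))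

module CoefficientCalculus {c ℓ : Level} (K : CommutativeRing c ℓ) (n : ℕ) where
  open CommutativeRing K renaming (Carrier to A)
  open import Algebra.Properties.Ring ring using (-1*x≈-x)
  open import Algebra.Properties.Group +-group
    using (x∙y⁻¹≈ε⇒x≈y; x≈y⇒x∙y⁻¹≈ε; //-rightDividesʳ; ⁻¹-anti-homo-//)
  open import Algebra.Properties.Semiring.Sum semiring
    using (sum; sum-syntax; sum⁺-syntax; sum-cong-≋; sum-replicate-zero; sum-init-last; ∑-distrib-+;
           *-distribˡ-sum)
  open import Algebra.Solver.Ring.AlmostCommutativeRing using (fromCommutativeRing; -raw-almostCommutative⟶)
  open import Algebra.Solver.Ring rawRing (fromCommutativeRing K) (-raw-almostCommutative⟶ _) (λ _ _ → nothing)
    using (solve; _:-_; _:=_)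

  sum-zero : ∀ m {f : Fin m → A} → (∀ k → f k ≈ 0#) → sum f ≈ 0#
  sum-zero m f≈0 = trans (sum-cong-≋ f≈0) (sum-replicate-zero m)

  sum-neg : ∀ {m} (f : Fin m → A) → sum (λ k → - f k) ≈ - sum f
  sum-neg f = begin
    sum (λ k → - f k)      ≈⟨ sum-cong-≋ (λ k → sym (-1*x≈-x (f k))) ⟩
    sum (λ k → - 1# * f k) ≈⟨ *-distribˡ-sum (- 1#) f ⟨
    - 1# * sum f           ≈⟨ -1*x≈-x (sum f) ⟩
    - sum f                ∎
    where open ≈-Reasoning setoid

  sum-sub : ∀ {m} (f g : Fin m → A) → sum (λ k → f k - g k) ≈ sum f - sum g
  sum-sub f g = trans (∑-distrib-+ f (λ k → - g k)) (+-congˡ (sum-neg g))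

  sub-sub : ∀ x₁ y₁ x₂ y₂ → (x₁ - y₁) - (x₂ - y₂) ≈ (x₁ - x₂) - (y₁ - y₂)
  sub-sub = solve 4 (λ x₁ y₁ x₂ y₂ → (x₁ :- y₁) :- (x₂ :- y₂) := (x₁ :- x₂) :- (y₁ :- y₂)) refl

  -- A polynomial in t₁,…,tₙ is handled through its coefficient function on exponent vectors;
  -- mulVar x, mulDiff x y and substVar a b act as multiplication by t_x, by t_x − t_y, and as the
  -- substitution of t_b for t_a.
  Coeffs : Set c
  Coeffs = Vec ℕ n → A

  infix 4 _≋_
  _≋_ : Coeffs → Coeffs → Set ℓ
  F ≋ G = ∀ M → F M ≈ G M

  0ᶜ : Coeffs
  0ᶜ M = 0#

  infixl 6 _⊖_
  _⊖_ : Coeffs → Coeffs → Coeffs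
  (F ⊖ G) M = F M - G M

  mulVar : Fin n → Coeffs → Coeffs
  mulVar x F M with lookup M x
  ... | zero  = 0#
  ... | suc e = F (M [ x ]≔ e)

  mulVar-zero : ∀ {x} F M → lookup M x ≡ 0 → mulVar x F M ≡ 0#
  mulVar-zero F M eq rewrite eq = ≡.refl

  mulVar-suc : ∀ {x e} F M → lookup M x ≡ suc e → mulVar x F M ≡ F (M [ x ]≔ e)
  mulVar-suc F M eq rewrite eq = ≡.refl

  mulVar-raise : ∀ x F N → mulVar x F (raise x N) ≡ F N
  mulVar-raise x F N = ≡.trans (mulVar-suc F (raise x N) (lookup∘update x N _))
                               (≡.cong F (≡.trans ([]≔-idempotent N x) ([]≔-lookup N x)))

  mulVar-cong : ∀ x {F G} → F ≋ G → mulVar x F ≋ mulVar x G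
  mulVar-cong x F≋G M with lookup M x
  ... | zero  = refl
  ... | suc e = F≋G (M [ x ]≔ e)

  mulVar-⊖ : ∀ x F G → mulVar x (F ⊖ G) ≋ mulVar x F ⊖ mulVar x G
  mulVar-⊖ x F G M with lookup M x
  ... | zero  = sym (-‿inverseʳ 0#)
  ... | suc e = refl

  mulDiff : Fin n → Fin n → Coeffs → Coeffs
  mulDiff x y F = mulVar x F ⊖ mulVar y F

  mulDiff-cong : ∀ x y {F G} → F ≋ G → mulDiff x y F ≋ mulDiff x y G
  mulDiff-cong x y F≋G M = +-cong (mulVar-cong x F≋G M) (-‿cong (mulVar-cong y F≋G M))

  mulDiff-⊖ : ∀ x y F G → mulDiff x y (F ⊖ G) ≋ mulDiff x y F ⊖ mulDiff x y G
  mulDiff-⊖ x y F G M = begin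
    mulVar x (F ⊖ G) M - mulVar y (F ⊖ G) M
      ≈⟨ +-cong (mulVar-⊖ x F G M) (-‿cong (mulVar-⊖ y F G M)) ⟩
    (mulVar x F M - mulVar x G M) - (mulVar y F M - mulVar y G M)
      ≈⟨ sub-sub _ _ _ _ ⟩
    (mulVar x F M - mulVar y F M) - (mulVar x G M - mulVar y G M) ∎
    where open ≈-Reasoning setoid

  mulDiff-antisym : ∀ x y {F G G′} → mulDiff y x F ≋ G ⊖ G′ → mulDiff x y F ≋ G′ ⊖ G
  mulDiff-antisym x y yxF≋G-G′ M =
    trans (sym (⁻¹-anti-homo-// _ _)) (trans (-‿cong (yxF≋G-G′ M)) (⁻¹-anti-homo-// _ _))

  mulDiff-self : ∀ x F → mulDiff x x F ≋ 0ᶜ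
  mulDiff-self x F M = -‿inverseʳ (mulVar x F M)

  -- t_x − t_y is a non-zero-divisor over any commutative ring: a vanishing product lets one trade
  -- a factor t_y for a factor t_x, and the t_y-exponent cannot decrease forever.
  mulDiff-cancel : ∀ {x y F} → x ≢ y → mulDiff x y F ≋ 0ᶜ → F ≋ 0ᶜ
  mulDiff-cancel {x} {y} {F} x≢y xyF≋0 M = go (lookup (raise x M) y) M ≡.refl
    where
    F≈mulVarʸ : ∀ N → F N ≈ mulVar y F (raise x N)
    F≈mulVarʸ N = trans (reflexive (≡.sym (mulVar-raise x F N))) (x∙y⁻¹≈ε⇒x≈y _ _ (xyF≋0 (raise x N)))

    go : ∀ e N → lookup (raise x N) y ≡ e → F N ≈ 0#
    go zero     N eq = trans (F≈mulVarʸ N) (reflexive (mulVar-zero F (raise x N) eq))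
    go (suc e′) N eq = begin
      F N                     ≈⟨ F≈mulVarʸ N ⟩
      mulVar y F (raise x N)  ≡⟨ mulVar-suc F (raise x N) eq ⟩
      F N′                    ≈⟨ go e′ N′ N′-raised ⟩
      0#                      ∎
      where
      open ≈-Reasoning setoid
      N′ : Vec ℕ n
      N′ = raise x N [ y ]≔ e′

      N′-raised : lookup (raise x N′) y ≡ e′
      N′-raised = ≡.trans (lookup∘update′ (x≢y ∘ ≡.sym) N′ _) (lookup∘update y (raise x N) e′)

  mulDiff-injective : ∀ {x y F G} → x ≢ y → mulDiff x y F ≋ mulDiff x y G → F ≋ G
  mulDiff-injective {x} {y} {F} {G} x≢y xyF≋xyG M = x∙y⁻¹≈ε⇒x≈y _ _ (mulDiff-cancel x≢y xy[F-G]≋0 M)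
    where
    xy[F-G]≋0 : mulDiff x y (F ⊖ G) ≋ 0ᶜ
    xy[F-G]≋0 N = trans (mulDiff-⊖ x y F G N) (x≈y⇒x∙y⁻¹≈ε (xyF≋xyG N))

  split : Fin n → Fin n → Vec ℕ n → (s : ℕ) → Fin (suc s) → Vec ℕ n
  split a b M s k = M [ a ]≔ toℕ k [ b ]≔ (s ∸ toℕ k)

  ∑splits : Fin n → Fin n → Coeffs → Vec ℕ n → ℕ → A
  ∑splits a b F M s = ∑[ k ≤ s ] F (split a b M s k)

  -- The value at M ignores the exponent M_a instead of vanishing when M_a ≠ 0.
  substVar : Fin n → Fin n → Coeffs → Coeffs
  substVar a b F M = ∑splits a b F M (lookup M b)

  substVar-cong : ∀ a b {F G} → F ≋ G → substVar a b F ≋ substVar a b G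
  substVar-cong a b {F} {G} F≋G M =
    sum-cong-≋ {x = F ∘ split a b M _} {y = G ∘ split a b M _} (F≋G ∘ split a b M _)

  substVar-⊖ : ∀ a b F G → substVar a b (F ⊖ G) ≋ substVar a b F ⊖ substVar a b G
  substVar-⊖ a b F G M = sum-sub (F ∘ split a b M _) (G ∘ split a b M _)

  module _ {a b : Fin n} (a≢b : a ≢ b) (F : Coeffs) where

    substVar-mulVarˡ : substVar a b (mulVar a F) ≋ mulVar b (substVar a b F)
    substVar-mulVarˡ M with lookup M b in eq
    ... | zero  = trans (+-congʳ (reflexive (mulVar-zero F (M [ a ]≔ 0 [ b ]≔ 0) (lookup-[]≔²ˡ a≢b M 0 0))))
                        (+-identityˡ 0#)
    ... | suc s = begin
      mulVar a F (V 0) + ∑[ k ≤ s ] mulVar a F (V (suc (toℕ k)))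
        ≈⟨ +-cong firstVanishes (sum-cong-≋ {suc s} shiftDown) ⟩
      0# + ∑splits a b F (M [ b ]≔ s) s
        ≈⟨ +-identityˡ _ ⟩
      ∑splits a b F (M [ b ]≔ s) s
        ≡⟨ ≡.cong (∑splits a b F (M [ b ]≔ s)) (lookup∘update b M s) ⟨
      substVar a b F (M [ b ]≔ s) ∎
      where
      open ≈-Reasoning setoid
      V : ℕ → Vec ℕ n
      V k = M [ a ]≔ k [ b ]≔ (suc s ∸ k)

      firstVanishes : mulVar a F (V 0) ≈ 0#
      firstVanishes = reflexive (mulVar-zero F (V 0) (lookup-[]≔²ˡ a≢b M 0 (suc s)))

      shiftDown : ∀ k → mulVar a F (V (suc (toℕ k))) ≈ F (split a b (M [ b ]≔ s) s k)
      shiftDown k = begin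
        mulVar a F (V (suc (toℕ k)))          ≡⟨ mulVar-suc F (V (suc (toℕ k))) (lookup-[]≔²ˡ a≢b M _ _) ⟩
        F (V (suc (toℕ k)) [ a ]≔ toℕ k)      ≡⟨ ≡.cong F ([]≔²-overwriteˡ a≢b M _ _ _) ⟩
        F (M [ a ]≔ toℕ k [ b ]≔ (s ∸ toℕ k)) ≡⟨ ≡.cong F ([]≔²-absorbʳ a≢b M _ _ s) ⟨
        F (split a b (M [ b ]≔ s) s k)        ∎

    substVar-mulVarʳ : substVar a b (mulVar b F) ≋ mulVar b (substVar a b F)
    substVar-mulVarʳ M with lookup M b in eq
    ... | zero  = trans (+-congʳ (reflexive (mulVar-zero F (M [ a ]≔ 0 [ b ]≔ 0) (lookup-[]≔²ʳ M 0 0))))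
                        (+-identityˡ 0#)
    ... | suc s = begin
      ∑[ k ≤ suc s ] term (toℕ k)
        ≈⟨ sum-init-last (term ∘ toℕ) ⟩
      ∑[ k ≤ s ] term (toℕ (inject₁ k)) + term (toℕ (Fin.fromℕ (suc s)))
        ≈⟨ +-cong (sum-cong-≋ {suc s} shiftDown) lastVanishes ⟩
      ∑splits a b F (M [ b ]≔ s) s + 0#
        ≈⟨ +-identityʳ _ ⟩
      ∑splits a b F (M [ b ]≔ s) s
        ≡⟨ ≡.cong (∑splits a b F (M [ b ]≔ s)) (lookup∘update b M s) ⟨
      substVar a b F (M [ b ]≔ s) ∎
      where
      open ≈-Reasoning setoid
      V : ℕ → Vec ℕ n
      V k = M [ a ]≔ k [ b ]≔ (suc s ∸ k)

      term : ℕ → A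
      term k = mulVar b F (V k)

      lastVanishes : term (toℕ (Fin.fromℕ (suc s))) ≈ 0#
      lastVanishes = reflexive (mulVar-zero F (V _) (≡.trans (lookup-[]≔²ʳ M _ _)
        (≡.trans (≡.cong (suc s ∸_) (toℕ-fromℕ (suc s))) (ℕₚ.n∸n≡0 (suc s)))))

      shiftDown : ∀ k → term (toℕ (inject₁ k)) ≈ F (split a b (M [ b ]≔ s) s k)
      shiftDown k = begin
        term (toℕ (inject₁ k))                ≡⟨ ≡.cong term (toℕ-inject₁ k) ⟩
        mulVar b F (V (toℕ k))                ≡⟨ mulVar-suc F (V (toℕ k)) (≡.trans (lookup-[]≔²ʳ M _ _) b-exponent) ⟩
        F (V (toℕ k) [ b ]≔ (s ∸ toℕ k))      ≡⟨ ≡.cong F ([]≔-idempotent _ b) ⟩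
        F (M [ a ]≔ toℕ k [ b ]≔ (s ∸ toℕ k)) ≡⟨ ≡.cong F ([]≔²-absorbʳ a≢b M _ _ s) ⟨
        F (split a b (M [ b ]≔ s) s k)        ∎
        where
        b-exponent : suc s ∸ toℕ k ≡ suc (s ∸ toℕ k)
        b-exponent = ℕₚ.+-∸-assoc 1 (toℕ≤pred[n] k)

  substVar-mulVar-other : ∀ {a b x} → x ≢ a → x ≢ b → ∀ F →
                          substVar a b (mulVar x F) ≋ mulVar x (substVar a b F)
  substVar-mulVar-other {a} {b} {x} x≢a x≢b F M with lookup M x in eq
  ... | zero  = sum-zero (suc (lookup M b)) (λ k → reflexive (mulVar-zero F (P k) (≡.trans (Px k) eq)))
    where
    P : Fin (suc (lookup M b)) → Vec ℕ n
    P = split a b M (lookup M b)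

    Px : ∀ k → lookup (P k) x ≡ lookup M x
    Px k = lookup-[]≔²-other x≢a x≢b M _ _
  ... | suc e = begin
    ∑splits a b (mulVar x F) M (lookup M b)
      ≈⟨ sum-cong-≋ {suc (lookup M b)} shiftDown ⟩
    ∑splits a b F (M [ x ]≔ e) (lookup M b)
      ≡⟨ ≡.cong (∑splits a b F (M [ x ]≔ e)) (lookup∘update′ (x≢b ∘ ≡.sym) M e) ⟨
    substVar a b F (M [ x ]≔ e) ∎
    where
    open ≈-Reasoning setoid
    shiftDown : ∀ k → mulVar x F (split a b M (lookup M b) k) ≈ F (split a b (M [ x ]≔ e) (lookup M b) k)
    shiftDown k = reflexive (≡.trans (mulVar-suc F _ (≡.trans (lookup-[]≔²-other x≢a x≢b M _ _) eq))
                                     (≡.cong F ([]≔²-commutes x≢a x≢b M _ _ e)))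

  substVar-mulVar : ∀ {a b} → a ≢ b → ∀ x F →
                    substVar a b (mulVar x F) ≋ mulVar (redirect a b x) (substVar a b F)
  substVar-mulVar {a} {b} a≢b x F with x ≟ a
  ... | yes ≡.refl = substVar-mulVarˡ a≢b F
  ... | no x≢a with x ≟ b
  ...   | yes ≡.refl = substVar-mulVarʳ a≢b F
  ...   | no x≢b     = substVar-mulVar-other x≢a x≢b F

  substVar-mulDiff : ∀ {a b} → a ≢ b → ∀ x y F →
                     substVar a b (mulDiff x y F) ≋ mulDiff (redirect a b x) (redirect a b y) (substVar a b F)
  substVar-mulDiff {a} {b} a≢b x y F M =
    trans (substVar-⊖ a b (mulVar x F) (mulVar y F) M)
          (+-cong (substVar-mulVar a≢b x F M) (-‿cong (substVar-mulVar a≢b y F M)))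

  substVar-mulDiff-self : ∀ {a b} → a ≢ b → ∀ F → substVar a b (mulDiff a b F) ≋ 0ᶜ
  substVar-mulDiff-self {a} {b} a≢b F M = begin
    substVar a b (mulDiff a b F) M
      ≈⟨ substVar-mulDiff a≢b a b F M ⟩
    mulDiff (redirect a b a) (redirect a b b) (substVar a b F) M
      ≡⟨ ≡.cong₂ (λ x y → mulDiff x y (substVar a b F) M)
                 (redirect-source a b) (redirect-other (a≢b ∘ ≡.sym)) ⟩
    mulDiff b b (substVar a b F) M
      ≈⟨ mulDiff-self b _ M ⟩
    0# ∎
    where open ≈-Reasoning setoid

  ∑shifts : Fin n → Fin n → Coeffs → Vec ℕ n → ℕ → ℕ → A
  ∑shifts a b Q M r s = ∑[ k ≤ s ] Q (M [ a ]≔ (r ℕ.+ suc (toℕ k)) [ b ]≔ (s ∸ toℕ k))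

  -- Expanding (t_a − t_b)⁻¹ = Σₖ t_b^k / t_a^(k+1); only k ≤ M_b contributes.
  quotient : Fin n → Fin n → Coeffs → Coeffs
  quotient a b Q M = ∑shifts a b Q M (lookup M a) (lookup M b)

  quotient-cong : ∀ a b {Q R} → Q ≋ R → quotient a b Q ≋ quotient a b R
  quotient-cong a b {Q} {R} Q≋R M = sum-cong-≋ {x = Q ∘ point} {y = R ∘ point} (Q≋R ∘ point)
    where
    point : Fin (suc (lookup M b)) → Vec ℕ n
    point k = M [ a ]≔ (lookup M a ℕ.+ suc (toℕ k)) [ b ]≔ (lookup M b ∸ toℕ k)

  module _ {a b : Fin n} (a≢b : a ≢ b) (Q : Coeffs) where

    private
      shifted : Vec ℕ n → ℕ → ℕ → ℕ → A
      shifted M r s k = Q (M [ a ]≔ (r ℕ.+ k) [ b ]≔ (s ∸ k))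

    mulVarʳ-quotient : ∀ M → mulVar b (quotient a b Q) M
                             ≈ ∑[ k < lookup M b ] shifted M (lookup M a) (lookup M b) (suc (toℕ k))
    mulVarʳ-quotient M with lookup M b in eq
    ... | zero  = refl
    ... | suc s = begin
      quotient a b Q (M [ b ]≔ s)
        ≡⟨ ≡.cong₂ (∑shifts a b Q (M [ b ]≔ s)) (lookup∘update′ a≢b M s) (lookup∘update b M s) ⟩
      ∑shifts a b Q (M [ b ]≔ s) (lookup M a) s
        ≈⟨ sum-cong-≋ {suc s} (λ k → reflexive (≡.cong Q (absorb k))) ⟩
      ∑[ k ≤ s ] shifted M (lookup M a) (suc s) (suc (toℕ k)) ∎
      where
      open ≈-Reasoning setoid
      absorb : ∀ k → M [ b ]≔ s [ a ]≔ (lookup M a ℕ.+ suc (toℕ k)) [ b ]≔ (s ∸ toℕ k)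
                   ≡ M [ a ]≔ (lookup M a ℕ.+ suc (toℕ k)) [ b ]≔ (s ∸ toℕ k)
      absorb k = []≔²-absorbʳ a≢b M _ _ s

    mulVarˡ-quotient : substVar a b Q ≋ 0ᶜ →
                       ∀ M → mulVar a (quotient a b Q) M
                             ≈ ∑[ k ≤ lookup M b ] shifted M (lookup M a) (lookup M b) (toℕ k)
    mulVarˡ-quotient vanishes M with lookup M a in eq
    ... | zero  = sym (vanishes M)
    ... | suc r = begin
      quotient a b Q (M [ a ]≔ r)
        ≡⟨ ≡.cong₂ (∑shifts a b Q (M [ a ]≔ r)) (lookup∘update a M r)
                   (lookup∘update′ (a≢b ∘ ≡.sym) M r) ⟩
      ∑shifts a b Q (M [ a ]≔ r) r (lookup M b)
        ≈⟨ sum-cong-≋ {suc (lookup M b)} (λ k → reflexive (≡.cong Q (absorb k))) ⟩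
      ∑[ k ≤ lookup M b ] shifted M (suc r) (lookup M b) (toℕ k) ∎
      where
      open ≈-Reasoning setoid
      absorb : ∀ k → M [ a ]≔ r [ a ]≔ (r ℕ.+ suc (toℕ k)) [ b ]≔ (lookup M b ∸ toℕ k)
                   ≡ M [ a ]≔ (suc r ℕ.+ toℕ k) [ b ]≔ (lookup M b ∸ toℕ k)
      absorb k = ≡.trans ([]≔²-absorbˡ M _ _ r)
                         (≡.cong (λ e → M [ a ]≔ e [ b ]≔ (lookup M b ∸ toℕ k)) (ℕₚ.+-suc r (toℕ k)))

    mulDiff-quotient : substVar a b Q ≋ 0ᶜ → Q ≋ mulDiff a b (quotient a b Q)
    mulDiff-quotient vanishes M = begin
      Q M                            ≡⟨ ≡.cong Q ([]≔²-lookup M) ⟨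
      Q (M [ a ]≔ r [ b ]≔ s)        ≡⟨ ≡.cong (λ e → Q (M [ a ]≔ e [ b ]≔ s)) (ℕₚ.+-identityʳ r) ⟨
      shifted M r s 0                ≈⟨ //-rightDividesʳ rest (shifted M r s 0) ⟨
      shifted M r s 0 + rest - rest  ≈⟨ +-cong (mulVarˡ-quotient vanishes M) (-‿cong (mulVarʳ-quotient M)) ⟨
      mulDiff a b (quotient a b Q) M ∎
      where
      open ≈-Reasoning setoid
      r s : ℕ
      r = lookup M a
      s = lookup M b

      rest : A
      rest = ∑[ k < s ] shifted M r s (suc (toℕ k))

  BoxSupported : ℕ → Coeffs → Set ℓ
  BoxSupported B F = ∀ M x → B < lookup M x → F M ≈ 0#

  quotient-support : ∀ {a b B Q} → a ≢ b → BoxSupported B Q → BoxSupported (B ℕ.+ B) (quotient a b Q)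
  quotient-support {a} {b} {B} {Q} a≢b Q-supp M x 2B<Mx =
    sum-zero (suc (lookup M b)) (λ k → term-vanishes (toℕ k))
    where
    P : ℕ → Vec ℕ n
    P k = M [ a ]≔ (lookup M a ℕ.+ suc k) [ b ]≔ (lookup M b ∸ k)

    B<Mx : B < lookup M x
    B<Mx = ℕₚ.≤-<-trans (ℕₚ.m≤m+n B B) 2B<Mx

    viaA : ∀ k → B < lookup M a ℕ.+ suc k → Q (P k) ≈ 0#
    viaA k B<Pa = Q-supp (P k) a (≡.subst (B <_) (≡.sym (lookup-[]≔²ˡ a≢b M _ _)) B<Pa)

    term-vanishes : ∀ k → Q (P k) ≈ 0#
    term-vanishes k with x ≟ a | x ≟ b
    ... | yes ≡.refl | _      = viaA k (ℕₚ.<-≤-trans B<Mx (ℕₚ.m≤m+n (lookup M a) (suc k)))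
    ... | no x≢a     | no x≢b = Q-supp (P k) x (≡.subst (B <_) (≡.sym (lookup-[]≔²-other x≢a x≢b M _ _)) B<Mx)
    ... | no _ | yes ≡.refl with B ℕ.<? lookup M b ∸ k
    ...   | yes B<Pb = Q-supp (P k) b (≡.subst (B <_) (≡.sym (lookup-[]≔²ʳ M _ _)) B<Pb)
    ...   | no B≮Pb  = viaA k (ℕₚ.<-≤-trans (ℕₚ.m<n⇒m<1+n B<k) (ℕₚ.m≤n+m (suc k) (lookup M a)))
      where
      B<k : B < k
      B<k = ℕₚ.+-cancelʳ-< B B k (ℕₚ.<-≤-trans 2B<Mx
              (ℕₚ.≤-trans (ℕₚ.m≤n+m∸n (lookup M b) k) (ℕₚ.+-monoʳ-≤ k (ℕₚ.≮⇒≥ B≮Pb))))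

  -- Congruence modulo t_a − t_b, detected by substituting t_b for t_a.  A record, so that the
  -- four indices can be inferred.
  infix 4 _≋_mod[_−_]
  record _≋_mod[_−_] (F G : Coeffs) (a b : Fin n) : Set ℓ where
    constructor mod
    field substVar-≋ : substVar a b F ≋ substVar a b G

  mod-setoid : Fin n → Fin n → Setoid c ℓ
  mod-setoid a b = record
    { Carrier       = Coeffs
    ; _≈_           = λ F G → F ≋ G mod[ a − b ]
    ; isEquivalence = record
      { refl  = mod (λ M → refl)
      ; sym   = λ (mod F≋G) → mod (λ M → sym (F≋G M))
      ; trans = λ (mod F≋G) (mod G≋H) → mod (λ M → trans (F≋G M) (G≋H M))
      }
    }

  ≋⇒mod : ∀ {a b F G} → F ≋ G → F ≋ G mod[ a − b ]
  ≋⇒mod {a} {b} F≋G = mod (substVar-cong a b F≋G)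

  ⊖-mod : ∀ {a b F F′ G G′} → F ≋ F′ mod[ a − b ] → G ≋ G′ mod[ a − b ] →
          F ⊖ G ≋ F′ ⊖ G′ mod[ a − b ]
  ⊖-mod {a} {b} {F} {F′} {G} {G′} (mod F≋F′) (mod G≋G′) = mod λ M → begin
    substVar a b (F ⊖ G) M                ≈⟨ substVar-⊖ a b F G M ⟩
    substVar a b F M - substVar a b G M   ≈⟨ +-cong (F≋F′ M) (-‿cong (G≋G′ M)) ⟩
    substVar a b F′ M - substVar a b G′ M ≈⟨ substVar-⊖ a b F′ G′ M ⟨
    substVar a b (F′ ⊖ G′) M              ∎
    where open ≈-Reasoning setoid

  module _ {a b : Fin n} (a≢b : a ≢ b) where

    mod-intro : ∀ {F G} Q → F ⊖ G ≋ mulDiff a b Q → F ≋ G mod[ a − b ]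
    mod-intro {F} {G} Q F-G≋abQ = mod λ M → x∙y⁻¹≈ε⇒x≈y _ _ (begin
      substVar a b F M - substVar a b G M ≈⟨ substVar-⊖ a b F G M ⟨
      substVar a b (F ⊖ G) M              ≈⟨ substVar-cong a b F-G≋abQ M ⟩
      substVar a b (mulDiff a b Q) M      ≈⟨ substVar-mulDiff-self a≢b Q M ⟩
      0#                                  ∎)
      where open ≈-Reasoning setoid

    mod-elim : ∀ {F G} → F ≋ G mod[ a − b ] → F ⊖ G ≋ mulDiff a b (quotient a b (F ⊖ G))
    mod-elim {F} {G} (mod F≋G) =
      mulDiff-quotient a≢b (F ⊖ G) (λ M → trans (substVar-⊖ a b F G M) (x≈y⇒x∙y⁻¹≈ε (F≋G M)))

    mulDiff-mod-redirect : ∀ {x x′ y y′} F →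
                           redirect a b x ≡ redirect a b x′ → redirect a b y ≡ redirect a b y′ →
                           mulDiff x y F ≋ mulDiff x′ y′ F mod[ a − b ]
    mulDiff-mod-redirect {x} {x′} {y} {y′} F x≡x′ y≡y′ = mod λ M → begin
      substVar a b (mulDiff x y F) M
        ≈⟨ substVar-mulDiff a≢b x y F M ⟩
      mulDiff (redirect a b x) (redirect a b y) (substVar a b F) M
        ≡⟨ ≡.cong₂ (λ x y → mulDiff x y (substVar a b F) M) x≡x′ y≡y′ ⟩
      mulDiff (redirect a b x′) (redirect a b y′) (substVar a b F) M
        ≈⟨ substVar-mulDiff a≢b x′ y′ F M ⟨
      substVar a b (mulDiff x′ y′ F) M ∎
      where open ≈-Reasoning setoid

    mulDiff-mod-cancel : ∀ {x y F G} → redirect a b x ≢ redirect a b y →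
                         mulDiff x y F ≋ mulDiff x y G mod[ a − b ] → F ≋ G mod[ a − b ]
    mulDiff-mod-cancel {x} {y} {F} {G} x′≢y′ (mod xyF≋xyG) = mod (mulDiff-injective x′≢y′ λ M → begin
      mulDiff x′ y′ (substVar a b F) M ≈⟨ substVar-mulDiff a≢b x y F M ⟨
      substVar a b (mulDiff x y F) M   ≈⟨ xyF≋xyG M ⟩
      substVar a b (mulDiff x y G) M   ≈⟨ substVar-mulDiff a≢b x y G M ⟩
      mulDiff x′ y′ (substVar a b G) M ∎)
      where
      open ≈-Reasoning setoid
      x′ y′ : Fin n
      x′ = redirect a b x
      y′ = redirect a b y

module PolynomialCoefficients {c ℓ : Level} (K : CommutativeRing c ℓ) {n : ℕ} where
  open CommutativeRing K renaming (Carrier to A)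
  open import Algebra.Properties.Ring ring using (-0#≈0#; -‿+-comm; -1*x≈-x)
  open Poly K n
  open CoefficientCalculus K n

  coeff-∷-≡ : ∀ a m p → coeff ((a , m) ∷ p) m ≈ a + coeff p m
  coeff-∷-≡ a m p with ≡-dec ℕ._≟_ m m
  ... | yes _  = refl
  ... | no m≢m = contradiction ≡.refl m≢m

  coeff-∷-≢ : ∀ a m {M} p → m ≢ M → coeff ((a , m) ∷ p) M ≈ coeff p M
  coeff-∷-≢ a m {M} p m≢M with ≡-dec ℕ._≟_ m M
  ... | yes m≡M = contradiction m≡M m≢M
  ... | no _    = refl

  coeff-+ᴾ : ∀ p q M → coeff (p +ᴾ q) M ≈ coeff p M + coeff q M
  coeff-+ᴾ []             q M = sym (+-identityˡ _)
  coeff-+ᴾ ((a , m) ∷ p) q M with ≡-dec ℕ._≟_ m M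
  ... | yes _ = trans (+-congˡ (coeff-+ᴾ p q M)) (sym (+-assoc _ _ _))
  ... | no _  = coeff-+ᴾ p q M

  coeff-negᴾ : ∀ p M → coeff (-ᴾ p) M ≈ - coeff p M
  coeff-negᴾ []             M = sym -0#≈0#
  coeff-negᴾ ((a , m) ∷ p) M with ≡-dec ℕ._≟_ m M
  ... | yes _ = trans (+-congˡ (coeff-negᴾ p M)) (-‿+-comm _ _)
  ... | no _  = coeff-negᴾ p M

  coeff-subᴾ : ∀ p q → coeff (p -ᴾ q) ≋ coeff p ⊖ coeff q
  coeff-subᴾ p q M = trans (coeff-+ᴾ p (-ᴾ q) M) (+-congˡ (coeff-negᴾ q M))

  -- Stated for any g computing these terms, since the term map inside _*ᴾ_ is an anonymous function.
  coeff-map-shift : ∀ (g : A × Vec ℕ n → A × Vec ℕ n) u x →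
                    (∀ b m → g (b , m) ≡ (u * b , zipWith ℕ._+_ (replicate n 0 [ x ]≔ 1) m)) →
                    ∀ p M → coeff (List.map g p) M ≈ u * mulVar x (coeff p) M
  coeff-map-shift g u x g≡ [] M with lookup M x
  ... | zero  = sym (zeroʳ u)
  ... | suc _ = sym (zeroʳ u)
  coeff-map-shift g u x g≡ ((b , m) ∷ p) M rewrite g≡ b m | unit+≡raise x m with lookup M x in eq
  ... | zero = begin
    coeff ((u * b , raise x m) ∷ List.map g p) M ≈⟨ coeff-∷-≢ (u * b) (raise x m) (List.map g p) (raise≢ eq) ⟩
    coeff (List.map g p) M                       ≈⟨ coeff-map-shift g u x g≡ p M ⟩
    u * mulVar x (coeff p) M                     ≡⟨ ≡.cong (u *_) (mulVar-zero (coeff p) M eq) ⟩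
    u * 0#                                       ∎
    where open ≈-Reasoning setoid
  ... | suc k with ≡-dec ℕ._≟_ m (M [ x ]≔ k)
  ...   | yes ≡.refl = begin
    coeff ((u * b , raise x m) ∷ List.map g p) M
      ≡⟨ ≡.cong (λ V → coeff ((u * b , V) ∷ List.map g p) M) (raise-lower {x = x} {M = M} eq) ⟩
    coeff ((u * b , M) ∷ List.map g p) M ≈⟨ coeff-∷-≡ (u * b) M (List.map g p) ⟩
    u * b + coeff (List.map g p) M       ≈⟨ +-congˡ (coeff-map-shift g u x g≡ p M) ⟩
    u * b + u * mulVar x (coeff p) M     ≡⟨ ≡.cong (λ e → u * b + u * e) (mulVar-suc (coeff p) M eq) ⟩
    u * b + u * coeff p m                ≈⟨ distribˡ u b (coeff p m) ⟨
    u * (b + coeff p m)                  ∎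
    where open ≈-Reasoning setoid
  ...   | no m≢M[x]≔k = begin
    coeff ((u * b , raise x m) ∷ List.map g p) M
      ≈⟨ coeff-∷-≢ (u * b) (raise x m) (List.map g p) (m≢M[x]≔k ∘ raise≡⇒lower eq) ⟩
    coeff (List.map g p) M   ≈⟨ coeff-map-shift g u x g≡ p M ⟩
    u * mulVar x (coeff p) M ≡⟨ ≡.cong (u *_) (mulVar-suc (coeff p) M eq) ⟩
    u * coeff p (M [ x ]≔ k) ∎
    where open ≈-Reasoning setoid

  coeff-mulDiff : ∀ a b p → coeff ((var a -ᴾ var b) *ᴾ p) ≋ mulDiff a b (coeff p)
  coeff-mulDiff a b p M = begin
    coeff ((var a -ᴾ var b) *ᴾ p) M
      ≈⟨ coeff-+ᴾ (List.map _ p) _ M ⟩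
    coeff (List.map _ p) M + coeff (List.map _ p +ᴾ []) M
      ≈⟨ +-congˡ (trans (coeff-+ᴾ (List.map _ p) [] M) (+-identityʳ _)) ⟩
    coeff (List.map _ p) M + coeff (List.map _ p) M
      ≈⟨ +-cong (coeff-map-shift _ 1# a (λ _ _ → ≡.refl) p M)
                (coeff-map-shift _ (- 1#) b (λ _ _ → ≡.refl) p M) ⟩
    1# * mulVar a (coeff p) M + - 1# * mulVar b (coeff p) M
      ≈⟨ +-cong (*-identityˡ _) (-1*x≈-x _) ⟩
    mulDiff a b (coeff p) M ∎
    where open ≈-Reasoning setoid

  maxExponent : Pol → ℕ
  maxExponent []             = 0
  maxExponent ((_ , m) ∷ p) = maxEntry m ℕ.⊔ maxExponent p

  coeff-boxSupported : ∀ p → BoxSupported (maxExponent p) (coeff p)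
  coeff-boxSupported []             M x _  = refl
  coeff-boxSupported ((a , m) ∷ p) M x lt =
    trans (coeff-∷-≢ a m p m≢M) (coeff-boxSupported p M x (ℕₚ.≤-<-trans (ℕₚ.m≤n⊔m (maxEntry m) _) lt))
    where
    m≢M : m ≢ M
    m≢M ≡.refl = ℕₚ.<⇒≱ lt (ℕₚ.≤-trans (lookup≤maxEntry m x) (ℕₚ.m≤m⊔n (maxEntry m) _))

module Reconstruction {c ℓ : Level} (K : CommutativeRing c ℓ) where
  open CommutativeRing K renaming (Carrier to A)
  private
    module P {n : ℕ} = Poly K n
    module C {n : ℕ} = CoefficientCalculus K n
  open P using (Pol; coeff)
  open C using (BoxSupported; _≋_)
  open PolynomialCoefficients K using (coeff-∷-≡; coeff-∷-≢; coeff-+ᴾ)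

  prefix : ∀ {n} → ℕ → Pol {n} → Pol {suc n}
  prefix e = List.map (map₂ (e ∷_))

  coeff-prefix-≡ : ∀ {n} e (p : Pol {n}) M → coeff (prefix e p) (e ∷ M) ≈ coeff p M
  coeff-prefix-≡ e []             M = refl
  coeff-prefix-≡ e ((a , m) ∷ p) M = by-cases (≡-dec ℕ._≟_ m M)
    where
    by-cases : Dec (m ≡ M) → coeff (prefix e ((a , m) ∷ p)) (e ∷ M) ≈ coeff ((a , m) ∷ p) M
    by-cases (yes ≡.refl) = trans (coeff-∷-≡ a (e ∷ m) (prefix e p))
                                  (trans (+-congˡ (coeff-prefix-≡ e p m)) (sym (coeff-∷-≡ a m p)))
    by-cases (no m≢M)     = trans (coeff-∷-≢ a (e ∷ m) (prefix e p) (m≢M ∘ ∷-injectiveʳ))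
                                  (trans (coeff-prefix-≡ e p M) (sym (coeff-∷-≢ a m p m≢M)))

  coeff-prefix-≢ : ∀ {n e y} → e ≢ y → ∀ (p : Pol {n}) M → coeff (prefix e p) (y ∷ M) ≈ 0#
  coeff-prefix-≢ e≢y []             M = refl
  coeff-prefix-≢ e≢y ((a , m) ∷ p) M =
    trans (coeff-∷-≢ a _ (prefix _ p) (e≢y ∘ ∷-injectiveˡ)) (coeff-prefix-≢ e≢y p M)

  stack : ∀ {n} → ℕ → (ℕ → Pol {n}) → Pol {suc n}
  stack zero    P = []
  stack (suc r) P = prefix r (P r) ++ stack r P

  coeff-stack-≥ : ∀ {n} r (P : ℕ → Pol {n}) {y} M → r ≤ y → coeff (stack r P) (y ∷ M) ≈ 0#
  coeff-stack-≥ zero    P M r≤y = refl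
  coeff-stack-≥ (suc r) P M r<y = begin
    coeff (prefix r (P r) ++ stack r P) (_ ∷ M)
      ≈⟨ coeff-+ᴾ (prefix r (P r)) (stack r P) _ ⟩
    coeff (prefix r (P r)) (_ ∷ M) + coeff (stack r P) (_ ∷ M)
      ≈⟨ +-cong (coeff-prefix-≢ (ℕₚ.<⇒≢ r<y) (P r) M) (coeff-stack-≥ r P M (ℕₚ.<⇒≤ r<y)) ⟩
    0# + 0#
      ≈⟨ +-identityˡ 0# ⟩
    0# ∎
    where open ≈-Reasoning setoid

  coeff-stack-< : ∀ {n} r (P : ℕ → Pol {n}) {y} M → y < r → coeff (stack r P) (y ∷ M) ≈ coeff (P y) M
  coeff-stack-< (suc r) P {y} M y<1+r with y ℕ.≟ r
  ... | yes ≡.refl = begin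
    coeff (prefix y (P y) ++ stack y P) (y ∷ M)
      ≈⟨ coeff-+ᴾ (prefix y (P y)) (stack y P) _ ⟩
    coeff (prefix y (P y)) (y ∷ M) + coeff (stack y P) (y ∷ M)
      ≈⟨ +-cong (coeff-prefix-≡ y (P y) M) (coeff-stack-≥ y P M ℕₚ.≤-refl) ⟩
    coeff (P y) M + 0#
      ≈⟨ +-identityʳ _ ⟩
    coeff (P y) M ∎
    where open ≈-Reasoning setoid
  ... | no y≢r = begin
    coeff (prefix r (P r) ++ stack r P) (y ∷ M)
      ≈⟨ coeff-+ᴾ (prefix r (P r)) (stack r P) _ ⟩
    coeff (prefix r (P r)) (y ∷ M) + coeff (stack r P) (y ∷ M)
      ≈⟨ +-cong (coeff-prefix-≢ (y≢r ∘ ≡.sym) (P r) M)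
                (coeff-stack-< r P M (ℕₚ.≤∧≢⇒< (ℕₚ.≤-pred y<1+r) y≢r)) ⟩
    0# + coeff (P y) M
      ≈⟨ +-identityˡ _ ⟩
    coeff (P y) M ∎
    where open ≈-Reasoning setoid

  fromCoeffs : ∀ n → ℕ → (Vec ℕ n → A) → Pol {n}
  fromCoeffs zero    B F = (F [] , []) ∷ []
  fromCoeffs (suc n) B F = stack (suc B) (λ e → fromCoeffs n B (F ∘ (e ∷_)))

  coeff-fromCoeffs : ∀ n {B F} → BoxSupported B F → coeff (fromCoeffs n B F) ≋ F
  coeff-fromCoeffs zero    {B} {F} _ [] = trans (coeff-∷-≡ (F []) [] []) (+-identityʳ _)
  coeff-fromCoeffs (suc n) {B} {F} F-supp (y ∷ M) with y ℕ.≤? B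
  ... | yes y≤B = trans (coeff-stack-< (suc B) rows M (ℕ.s≤s y≤B))
                        (coeff-fromCoeffs n (λ M′ x → F-supp (y ∷ M′) (Fin.suc x)) M)
    where
    rows : ℕ → Pol {n}
    rows e = fromCoeffs n B (F ∘ (e ∷_))
  ... | no y≰B  = trans (coeff-stack-≥ (suc B) rows M B<y) (sym (F-supp (y ∷ M) Fin.zero B<y))
    where
    rows : ℕ → Pol {n}
    rows e = fromCoeffs n B (F ∘ (e ∷_))

    B<y : B < y
    B<y = ℕₚ.≰⇒> y≰B

module Conditions {c ℓ : Level} (K : CommutativeRing c ℓ) (n : ℕ) where
  open CommutativeRing K renaming (Carrier to A)
  open GKM K n
  open CoefficientCalculus K n
  open PolynomialCoefficients K {n}
  open Reconstruction K using (fromCoeffs; coeff-fromCoeffs)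

  module _ {j k : Fin n} (j≢k : j ≢ k) (h : H) where
    private
      τ : Perm n
      τ = transpose j k

      separates : ∀ v → v ⟨$⟩ʳ j ≢ v ⟨$⟩ʳ k
      separates v = ⟨$⟩ʳ-≢ v j≢k

      Δ : Perm n → Pol
      Δ v = h v -ᴾ (h ⋆ τ) v

    Cond⇒mod : Cond j k h → ∀ v → coeff (h v) ≋ coeff ((h ⋆ τ) v) mod[ v ⟨$⟩ʳ j − v ⟨$⟩ʳ k ]
    Cond⇒mod (g , _ , Δ≈g) v = mod-intro (separates v) (coeff (g v)) (λ M → begin
      coeff (h v) M - coeff ((h ⋆ τ) v) M              ≈⟨ coeff-subᴾ (h v) ((h ⋆ τ) v) M ⟨
      coeff (Δ v) M                                    ≈⟨ Δ≈g v M ⟩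
      coeff ((var (v ⟨$⟩ʳ j) -ᴾ var (v ⟨$⟩ʳ k)) *ᴾ g v) M ≈⟨ coeff-mulDiff _ _ (g v) M ⟩
      mulDiff (v ⟨$⟩ʳ j) (v ⟨$⟩ʳ k) (coeff (g v)) M     ∎)
      where open ≈-Reasoning setoid

    mod⇒Cond : InH h → (∀ v → coeff (h v) ≋ coeff ((h ⋆ τ) v) mod[ v ⟨$⟩ʳ j − v ⟨$⟩ʳ k ]) →
               Cond j k h
    mod⇒Cond h-inH h-mod = G , G-inH , Δ≈G
      where
      Q : Perm n → Coeffs
      Q v = quotient (v ⟨$⟩ʳ j) (v ⟨$⟩ʳ k) (coeff (Δ v))

      G : H
      G v = fromCoeffs n (maxExponent (Δ v) ℕ.+ maxExponent (Δ v)) (Q v)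

      coeff-G : ∀ v → coeff (G v) ≋ Q v
      coeff-G v = coeff-fromCoeffs n (quotient-support (separates v) (coeff-boxSupported (Δ v)))

      Δ≈G : ∀ v → Δ v ≈ᴾ ((var (v ⟨$⟩ʳ j) -ᴾ var (v ⟨$⟩ʳ k)) *ᴾ G v)
      Δ≈G v M = begin
        coeff (Δ v) M                               ≈⟨ coeff-subᴾ (h v) _ M ⟩
        (coeff (h v) ⊖ coeff ((h ⋆ τ) v)) M         ≈⟨ mod-elim (separates v) (h-mod v) M ⟩
        mulDiff a b (quotient a b (coeff (h v) ⊖ coeff ((h ⋆ τ) v))) M
          ≈⟨ mulDiff-cong a b (quotient-cong a b (λ N → sym (coeff-subᴾ (h v) _ N))) M ⟩
        mulDiff a b (Q v) M                         ≈⟨ mulDiff-cong a b (coeff-G v) M ⟨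
        mulDiff a b (coeff (G v)) M                 ≈⟨ coeff-mulDiff a b (G v) M ⟨
        coeff ((var a -ᴾ var b) *ᴾ G v) M           ∎
        where
        open ≈-Reasoning setoid
        a b : Fin n
        a = v ⟨$⟩ʳ j
        b = v ⟨$⟩ʳ k

      G-inH : InH G
      G-inH {v} {w} v≈w M = begin
        coeff (G v) M                                 ≈⟨ coeff-G v M ⟩
        quotient (v ⟨$⟩ʳ j) (v ⟨$⟩ʳ k) (coeff (Δ v)) M
          ≡⟨ ≡.cong₂ (λ a b → quotient a b (coeff (Δ v)) M) (v≈w j) (v≈w k) ⟩
        quotient (w ⟨$⟩ʳ j) (w ⟨$⟩ʳ k) (coeff (Δ v)) M ≈⟨ quotient-cong _ _ Δv≈Δw M ⟩
        quotient (w ⟨$⟩ʳ j) (w ⟨$⟩ʳ k) (coeff (Δ w)) M ≈⟨ coeff-G w M ⟨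
        coeff (G w) M                                 ∎
        where
        open ≈-Reasoning setoid
        Δv≈Δw : coeff (Δ v) ≋ coeff (Δ w)
        Δv≈Δw N = begin
          coeff (Δ v) N                       ≈⟨ coeff-subᴾ (h v) _ N ⟩
          coeff (h v) N - coeff ((h ⋆ τ) v) N
            ≈⟨ +-cong (h-inH v≈w N) (-‿cong (h-inH (v≈w ∘ (τ ⟨$⟩ˡ_)) N)) ⟩
          coeff (h w) N - coeff ((h ⋆ τ) w) N ≈⟨ coeff-subᴾ (h w) _ N ⟨
          coeff (Δ w) N                       ∎

module DividedDifference {c ℓ r : Level} (K : CommutativeRing c ℓ) {n : ℕ} {p q : Fin n} (p≢q : p ≢ q)
  (C : Perm n → Set r) (C-resp : ∀ σ ρ → σ ≈ₚ ρ → C σ → C ρ)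
  (C-conj : ∀ σ → C σ → C ((transpose p q · σ) · transpose p q)) where
  open CommutativeRing K renaming (Carrier to A)
  open GKM K n
  open CoefficientCalculus K n
  open PolynomialCoefficients K {n}
  open Conditions K n

  private
    s : Perm n
    s = transpose p q

  module _ {f g : H} (f-inH : InH f) (g-inH : InH g)
           (∂f≈g : (f -ᴴ (f ⋆ s)) ≈ᴴ ((xᴴ p -ᴴ xᴴ q) *ᴴ g)) where

    ∂-coeff : ∀ v → coeff (f v) ⊖ coeff ((f ⋆ s) v) ≋ mulDiff (v ⟨$⟩ʳ p) (v ⟨$⟩ʳ q) (coeff (g v))
    ∂-coeff v M = trans (sym (coeff-subᴾ (f v) _ M)) (trans (∂f≈g v M) (coeff-mulDiff _ _ (g v) M))

    g-s-invariant : ∀ v → coeff (g v) ≋ coeff ((g ⋆ s) v)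
    g-s-invariant v = mulDiff-injective (⟨$⟩ʳ-≢ v p≢q) (λ M → trans (sym (∂-coeff v M)) (sym (swapped M)))
      where
      w : Perm n
      w = v · (s ⁻¹)

      f-ss : coeff ((f ⋆ s) w) ≋ coeff (f v)
      f-ss = f-inH (λ x → ≡.cong (v ⟨$⟩ʳ_) (transpose-involutive q p x))

      swapped : mulDiff (v ⟨$⟩ʳ p) (v ⟨$⟩ʳ q) (coeff (g w)) ≋ coeff (f v) ⊖ coeff (f w)
      swapped = mulDiff-antisym _ _ (λ M → begin
        mulDiff (v ⟨$⟩ʳ q) (v ⟨$⟩ʳ p) (coeff (g w)) M
          ≡⟨ ≡.cong₂ (λ a b → mulDiff (v ⟨$⟩ʳ a) (v ⟨$⟩ʳ b) (coeff (g w)) M)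
                     (transpose-matchʳ q p) (transpose-matchˡ q p) ⟨
        mulDiff (w ⟨$⟩ʳ p) (w ⟨$⟩ʳ q) (coeff (g w)) M ≈⟨ ∂-coeff w M ⟨
        coeff (f w) M - coeff ((f ⋆ s) w) M           ≈⟨ +-congˡ (-‿cong (f-ss M)) ⟩
        coeff (f w) M - coeff (f v) M                 ∎)
        where open ≈-Reasoning setoid

    module _ (f-cond : ∀ j k → j ≢ k → C (transpose j k) → Cond j k f)
             {j k : Fin n} (j≢k : j ≢ k) (τ∈C : C (transpose j k)) where
      private
        j′ k′ : Fin n
        j′ = PC.transpose p q j
        k′ = PC.transpose p q k

        τ τ′ : Perm n
        τ = transpose j k
        τ′ = transpose j′ k′

        j′≢k′ : j′ ≢ k′
        j′≢k′ = ⟨$⟩ʳ-≢ s j≢k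

        τ′∈C : C τ′
        τ′∈C = C-resp _ _ sτs≈τ′ (C-conj τ τ∈C)
          where
          sτs≈τ′ : ((s · τ) · s) ≈ₚ τ′
          sτs≈τ′ x = ≡.trans (⟨$⟩ʳ-transpose s j k (s ⟨$⟩ʳ x))
                             (≡.cong (PC.transpose j′ k′) (transpose-involutive p q x))

      g-τ-invariant : (j ≡ p × k ≡ q) ⊎ (j ≡ q × k ≡ p) →
                      ∀ v → coeff (g v) ≋ coeff ((g ⋆ τ) v) mod[ v ⟨$⟩ʳ j − v ⟨$⟩ʳ k ]
      g-τ-invariant τ≡s v =
        ≋⇒mod (λ M → trans (g-s-invariant v M) (g-inH (≡.cong (v ⟨$⟩ʳ_) ∘ s⁻¹≗τ⁻¹ τ≡s) M))
        where
        s⁻¹≗τ⁻¹ : (j ≡ p × k ≡ q) ⊎ (j ≡ q × k ≡ p) → ∀ x → PC.transpose q p x ≡ PC.transpose k j x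
        s⁻¹≗τ⁻¹ (inj₁ (j≡p , k≡q)) x = ≡.cong₂ (λ a b → PC.transpose b a x) (≡.sym j≡p) (≡.sym k≡q)
        s⁻¹≗τ⁻¹ (inj₂ (j≡q , k≡p)) x =
          ≡.trans (transpose-comm q p x) (≡.cong₂ (λ a b → PC.transpose b a x) (≡.sym j≡q) (≡.sym k≡p))

      g-mod : ¬ ((j ≡ p × k ≡ q) ⊎ (j ≡ q × k ≡ p)) →
              ∀ v → coeff (g v) ≋ coeff ((g ⋆ τ) v) mod[ v ⟨$⟩ʳ j − v ⟨$⟩ʳ k ]
      g-mod τ≢s v = mulDiff-mod-cancel α≢β p′≢q′ (begin
        mulDiff (v ⟨$⟩ʳ p) (v ⟨$⟩ʳ q) (coeff (g v)) ≈⟨ ≋⇒mod (∂-coeff v) ⟨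
        coeff (f v) ⊖ coeff (f w)                  ≈⟨ ⊖-mod f-τ f-τ′ ⟩
        coeff (f u) ⊖ coeff ((f ⋆ s) u)            ≈⟨ ≋⇒mod (∂-coeff u) ⟩
        mulDiff (u ⟨$⟩ʳ p) (u ⟨$⟩ʳ q) (coeff (g u))
          ≈⟨ mulDiff-mod-redirect α≢β (coeff (g u)) (u-redirect p) (u-redirect q) ⟩
        mulDiff (v ⟨$⟩ʳ p) (v ⟨$⟩ʳ q) (coeff (g u)) ∎)
        where
        α β : Fin n
        α = v ⟨$⟩ʳ j
        β = v ⟨$⟩ʳ k

        open ≈-Reasoning (mod-setoid α β)

        α≢β : α ≢ β
        α≢β = ⟨$⟩ʳ-≢ v j≢k

        u w : Perm n
        u = v · (τ ⁻¹)
        w = v · (s ⁻¹)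

        u-redirect : ∀ x → redirect α β (u ⟨$⟩ʳ x) ≡ redirect α β (v ⟨$⟩ʳ x)
        u-redirect x =
          ≡.trans (≡.cong (redirect α β) (⟨$⟩ʳ-transpose v k j x)) (redirect-transpose α≢β (v ⟨$⟩ʳ x))

        p′≢q′ : redirect α β (v ⟨$⟩ʳ p) ≢ redirect α β (v ⟨$⟩ʳ q)
        p′≢q′ = τ≢s ∘ from-collision ∘ redirect-collision (⟨$⟩ʳ-≢ v p≢q)
          where
          v-injective : ∀ {x y} → v ⟨$⟩ʳ x ≡ v ⟨$⟩ʳ y → x ≡ y
          v-injective = ⟨$⟩ʳ-injective v

          from-collision : (v ⟨$⟩ʳ p ≡ α × v ⟨$⟩ʳ q ≡ β) ⊎ (v ⟨$⟩ʳ p ≡ β × v ⟨$⟩ʳ q ≡ α) →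
                           (j ≡ p × k ≡ q) ⊎ (j ≡ q × k ≡ p)
          from-collision (inj₁ (vp≡α , vq≡β)) = inj₁ (≡.sym (v-injective vp≡α) , ≡.sym (v-injective vq≡β))
          from-collision (inj₂ (vp≡β , vq≡α)) = inj₂ (≡.sym (v-injective vq≡α) , ≡.sym (v-injective vp≡β))

        f-τ : coeff (f v) ≋ coeff (f u) mod[ α − β ]
        f-τ = Cond⇒mod j≢k f (f-cond j k j≢k τ∈C) v

        f-τ′ : coeff (f w) ≋ coeff ((f ⋆ s) u) mod[ α − β ]
        f-τ′ = ≡.subst₂ (λ a b → coeff (f w) ≋ coeff ((f ⋆ s) u) mod[ a − b ]) wj′≡α wk′≡β
                        (Setoid.trans (mod-setoid _ _) (Cond⇒mod j′≢k′ f (f-cond j′ k′ j′≢k′ τ′∈C) w)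
                                                       (≋⇒mod (f-inH wτ′≈us)))
          where
          wj′≡α : w ⟨$⟩ʳ j′ ≡ α
          wj′≡α = ≡.cong (v ⟨$⟩ʳ_) (PC.transpose-inverse q p)

          wk′≡β : w ⟨$⟩ʳ k′ ≡ β
          wk′≡β = ≡.cong (v ⟨$⟩ʳ_) (PC.transpose-inverse q p)

          wτ′≈us : (w · (τ′ ⁻¹)) ≈ₚ (u · (s ⁻¹))
          wτ′≈us x = ≡.cong (v ⟨$⟩ʳ_) (≡.trans (⟨$⟩ʳ-transpose (s ⁻¹) k′ j′ x)
            (≡.cong₂ (λ a b → PC.transpose a b (PC.transpose q p x))
                     (PC.transpose-inverse q p) (PC.transpose-inverse q p)))

  divDiff-preserves : ∀ {f g} → InH[ C ] f → IsDivDiff p q f g → InH[ C ] g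
  divDiff-preserves {f} {g} (f-inH , f-cond) (g-inH , ∂f≈g) = g-inH , g-cond
    where
    g-cond : ∀ j k → j ≢ k → C (transpose j k) → Cond j k g
    g-cond j k j≢k τ∈C = mod⇒Cond j≢k g g-inH (by-cases ((j ≟ p ×-dec k ≟ q) ⊎-dec (j ≟ q ×-dec k ≟ p)))
      where
      by-cases : Dec ((j ≡ p × k ≡ q) ⊎ (j ≡ q × k ≡ p)) →
                 ∀ v → coeff (g v) ≋ coeff ((g ⋆ transpose j k) v) mod[ v ⟨$⟩ʳ j − v ⟨$⟩ʳ k ]
      by-cases (yes τ≡s) = g-τ-invariant {f} {g} f-inH g-inH ∂f≈g f-cond j≢k τ∈C τ≡s
      by-cases (no τ≢s)  = g-mod {f} {g} f-inH g-inH ∂f≈g f-cond j≢k τ∈C τ≢s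

lemma4p1 : ∀ {c ℓ p : Level} (K : CommutativeRing c ℓ) → IsIntegralDomain K →
    (m : ℕ) (i : Fin m) (C : Perm (suc m) → Set p) →
    (∀ σ → C σ → IsTransposition σ) →
    (∀ σ ρ → σ ≈ₚ ρ → C σ → C ρ) →
    C (transpose (inject₁ i) (fsuc i)) →
    (∀ σ → C σ → C ((transpose (inject₁ i) (fsuc i) · σ) · transpose (inject₁ i) (fsuc i))) →
    (∀ σ → C ((transpose (inject₁ i) (fsuc i) · σ) · transpose (inject₁ i) (fsuc i)) → C σ) →
    let open GKM K (suc m) in
    (∀ f → InH[ C ] f → Cond (inject₁ i) (fsuc i) f)
    × (∀ f g → InH[ C ] f → IsDivDiff (inject₁ i) (fsuc i) f g → InH[ C ] g)
lemma4p1 K _ m i C _ C-resp sᵢ∈C C-conj _ =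
  (λ f (_ , f-cond) → f-cond _ _ i≢1+i sᵢ∈C) ,
  (λ f g → DividedDifference.divDiff-preserves K i≢1+i C C-resp C-conj {f} {g})
  where
  i≢1+i : inject₁ i ≢ fsuc i
  i≢1+i = Finₚ.<⇒≢ (Finₚ.≤̄⇒inject₁< ℕₚ.≤-refl)
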